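{- Let $G$ be a weighted undirected graph with predictions satisfying $(1-\varepsilon)d_G(v,g)\le f(v)\le(1+\varepsilon)d_G(v,g)$ for all $v$, where $\varepsilon\in(0,1)$, and let $\beta>0$ satisfy $\frac{1+\varepsilon}{2}<\beta<1-\varepsilon$. Then the distance traversed by the algorithm described in the context on the $i$-th iteration satisfies $$d_{G_i}(v_{i-1},v_i)\le\frac{\beta}{2\beta-1-\varepsilon}\,\Delta_i+\frac{2\varepsilon}{2\beta-1-\varepsilon}\,d_G(v_i,g).$$
   Context: Exploration setting: $G=(V,E)$ is a finite connected undirected graph with positive edge weights and shortest-path distance $d_G$, root $r$, unknown goal $g$ recognized upon visiting. For $S\subseteq V$, $\partial S$ is the set of vertices outside $S$ adjacent to $S$. Having visited $V_{i-1}$, the agent knows only the subgraph $G_i$ with vertex set $V_{i-1}\cup\partial V_{i-1}$ and all edges incident to $V_{i-1}$, and the predictions $f$ at those vertices; $d_{G_i}$ is the shortest-path distance in $G_i$. The algorithm: $v_0=r$, $V_0=\{r\}$; while $v_{i-1}\ne g$, choose $v_i\in\arg\min_{v\in\partial V_{i-1}}\big(\beta\, d_{G_i}(v_{i-1},v)+f(v)\big)$, travel to $v_i$ along a shortest path in $G_i$ (cost $d_{G_i}(v_{i-1},v_i)$), and set $V_i=\{v_0,\dots,v_i\}$. The progress is $\Delta_i=d_G(v_{i-1},g)-d_G(v_i,g)$.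
   Formalization: The edge weights, the predictions $f$ and the parameters $\varepsilon$ and $\beta$ are rational. -}

module Defs where

open import Data.Nat using (ℕ)
open import Data.Fin using (Fin)
open import Data.Maybe using (Maybe; just; nothing)
open import Data.List using (List; []; _∷_)
open import Data.List.Membership.Propositional using (_∈_; _∉_)
open import Data.Product using (Σ; ∃; _×_; _,_)
open import Data.Sum using (_⊎_)
open import Data.Unit using (⊤)
open import Relation.Binary.PropositionalEquality using (_≡_; _≢_)
open import Data.Rational using (ℚ; 0ℚ; _+_; _*_; _≤_; _<_)

-- A finite undirected graph on vertex set Fin n with positive rational
-- edge weights: w u v ≡ just c means {u,v} is an edge of weight c.
record WGraph (n : ℕ) : Set where
  field
    w     : Fin n → Fin n → Maybe ℚ
    w-sym : ∀ u v → w u v ≡ w v u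
    w-irr : ∀ u → w u u ≡ nothing
    w-pos : ∀ u v c → w u v ≡ just c → 0ℚ < c

open WGraph public

data Walk {n : ℕ} (G : WGraph n) (P : Fin n → Fin n → Set)
     : Fin n → Fin n → ℚ → Set where
  here : ∀ {u} → Walk G P u u 0ℚ
  step : ∀ {u v x c ℓ} → w G u v ≡ just c → P u v →
         Walk G P v x ℓ → Walk G P u x (c + ℓ)

AllEdges : ∀ {n} → Fin n → Fin n → Set
AllEdges _ _ = ⊤

IsDist : ∀ {n} → WGraph n → (Fin n → Fin n → Set) → Fin n → Fin n → ℚ → Set
IsDist G P u v δ = Walk G P u v δ × (∀ ℓ → Walk G P u v ℓ → δ ≤ ℓ)

Connected : ∀ {n} → WGraph n → Set
Connected {n} G = ∀ (u v : Fin n) → ∃ λ ℓ → Walk G AllEdges u v ℓ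

Boundary : ∀ {n} → WGraph n → List (Fin n) → Fin n → Set
Boundary {n} G S v = v ∉ S × Σ (Fin n) λ u → u ∈ S × ∃ λ c → w G u v ≡ just c

-- Edges of the known graph G_i when S = V_{i-1} has been visited:
-- exactly the edges incident to S (its vertex set is then S ∪ ∂S).
Known : ∀ {n} → List (Fin n) → Fin n → Fin n → Set
Known S a b = a ∈ S ⊎ b ∈ S

Chosen : ∀ {n} → WGraph n → (f : Fin n → ℚ) → (β : ℚ) →
         List (Fin n) → Fin n → Fin n → Set
Chosen G f β S u v =
  Boundary G S v ×
  (∀ x δx δv → Boundary G S x → IsDist G (Known S) u x δx →
     IsDist G (Known S) u v δv → β * δv + f v ≤ β * δx + f x)

-- Run G f β r g u S : the algorithm started at root r with goal g can reach
-- the state where it stands at u = v_i having visited S = V_i (listed most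
-- recent first: v_i ∷ … ∷ v_0).
data Run {n : ℕ} (G : WGraph n) (f : Fin n → ℚ) (β : ℚ) (r g : Fin n)
     : Fin n → List (Fin n) → Set where
  start : Run G f β r g r (r ∷ [])
  next  : ∀ {u v S} → Run G f β r g u S → u ≢ g → Chosen G f β S u v →
          Run G f β r g v (v ∷ S)

{-# OPTIONS --safe #-}
-- Let x be the first vertex outside V_{i-1} on a shortest path from v_{i-1} to g.
-- Then x ∈ ∂V_{i-1}, and the path splits at x into a shortest path of G_i of length
-- p and a shortest path of G of length q with p + q = d_G(v_{i-1}, g). Comparing the
-- greedy choice v_i with the candidate x gives β d_{G_i}(v_{i-1}, v_i) + f(v_i) ≤ β p + f(x);
-- the prediction bounds on f(v_i) and f(x), the triangle inequality
-- d_G(v_{i-1}, g) ≤ d_{G_i}(v_{i-1}, v_i) + d_G(v_i, g) and β ≤ 1 + ε then give the bound.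
module Submission where

open import Defs
open import Data.Nat using (ℕ)
open import Data.Fin using (Fin)
open import Data.List using (List)
open import Data.Product using (_×_)
open import Relation.Binary.PropositionalEquality using (_≢_)
open import Data.Rational using (ℚ; 0ℚ; 1ℚ; ½; _+_; _-_; _*_; _≤_; _<_)

open import Data.Empty using (⊥-elim)
open import Data.Fin.Properties using (_≟_)
open import Data.List using (_∷_)
open import Data.List.Membership.Propositional using (_∈_; _∉_)
open import Data.List.Relation.Unary.Any using (here; there)
open import Data.Product using (_,_; proj₁; proj₂)
open import Data.Rational using (-_; nonNegative)
open import Data.Rational.Properties hiding (_≟_)
open import Data.Rational.Solver using (module +-*-Solver)
open import Data.Sum using (inj₁)
open import Relation.Binary.Core using (_⇒_)
open import Relation.Binary.PropositionalEquality using (_≡_; refl; sym; trans; cong; subst)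
open import Relation.Nullary using (yes; no)

module _ where
  open ≤-Reasoning

  p≤q⇒0≤q-p : ∀ {p q} → p ≤ q → 0ℚ ≤ q - p
  p≤q⇒0≤q-p {p} {q} p≤q = begin
    0ℚ     ≡⟨ sym (+-inverseʳ p) ⟩
    p - p  ≤⟨ +-monoˡ-≤ (- p) p≤q ⟩
    q - p  ∎

  0≤p⇒0≤q⇒0≤p*q : ∀ {p q} → 0ℚ ≤ p → 0ℚ ≤ q → 0ℚ ≤ p * q
  0≤p⇒0≤q⇒0≤p*q {p} {q} 0≤p 0≤q = begin
    0ℚ      ≡⟨ sym (*-zeroʳ p) ⟩
    p * 0ℚ  ≤⟨ *-monoˡ-≤-nonNeg p {{nonNegative 0≤p}} 0≤q ⟩
    p * q   ∎

  q≡p+s⇒0≤s⇒p≤q : ∀ {p q s} → q ≡ p + s → 0ℚ ≤ s → p ≤ q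
  q≡p+s⇒0≤s⇒p≤q {p} {q} {s} refl 0≤s = begin
    p       ≡⟨ sym (+-identityʳ p) ⟩
    p + 0ℚ  ≤⟨ +-monoʳ-≤ p 0≤s ⟩
    p + s   ∎

  +-cancelʳ-≤ : ∀ {p q} r → p + r ≤ q + r → p ≤ q
  +-cancelʳ-≤ {p} {q} r p+r≤q+r = begin
    p            ≡⟨ sym (cancel p) ⟩
    p + r - r    ≤⟨ +-monoˡ-≤ (- r) p+r≤q+r ⟩
    q + r - r    ≡⟨ cancel q ⟩
    q            ∎
    where
    cancel : ∀ z → z + r - r ≡ z
    cancel z = trans (+-assoc z r (- r)) (trans (cong (z +_) (+-inverseʳ r)) (+-identityʳ z))

  +-cancelˡ-≤ : ∀ {p q} r → r + p ≤ r + q → p ≤ q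
  +-cancelˡ-≤ {p} {q} r r+p≤r+q =
    +-cancelʳ-≤ r (subst (_≤ q + r) (+-comm r p) (subst (r + p ≤_) (+-comm r q) r+p≤r+q))

  0≤p⇒1-p≤1+p : ∀ {p} → 0ℚ ≤ p → 1ℚ - p ≤ 1ℚ + p
  0≤p⇒1-p≤1+p 0≤p = +-monoʳ-≤ 1ℚ (≤-trans (neg-antimono-≤ 0≤p) 0≤p)

-- The slack is the sum of the greedy choice, the two prediction bounds, and
-- (1 + ε − β) times both p ≥ 0 and the triangle inequality.
greedy-step-bound : ∀ β ε dstep dprev dnext p q fv fx → dprev ≡ p + q →
  β * dstep + fv ≤ β * p + fx → (1ℚ - ε) * dnext ≤ fv → fx ≤ (1ℚ + ε) * q →
  0ℚ ≤ p → dprev ≤ dstep + dnext → β ≤ 1ℚ + ε →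
  (β + β - 1ℚ - ε) * dstep ≤ β * (dprev - dnext) + (ε + ε) * dnext
greedy-step-bound β ε dstep _ dnext p q fv fx refl greedy lower upper 0≤p triangle β≤1+ε =
  q≡p+s⇒0≤s⇒p≤q slack-sum
    (+-mono-≤ (+-mono-≤ (+-mono-≤ (+-mono-≤ (p≤q⇒0≤q-p greedy) (p≤q⇒0≤q-p lower))
                                  (p≤q⇒0≤q-p upper))
                        (0≤p⇒0≤q⇒0≤p*q 0≤k 0≤p))
              (0≤p⇒0≤q⇒0≤p*q 0≤k (p≤q⇒0≤q-p triangle)))
  where
  open +-*-Solver
  0≤k : 0ℚ ≤ (1ℚ + ε) - β
  0≤k = p≤q⇒0≤q-p β≤1+ε
  slack-sum :
    β * ((p + q) - dnext) + (ε + ε) * dnext ≡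
    (β + β - 1ℚ - ε) * dstep +
      (((((β * p + fx) - (β * dstep + fv)) + (fv - (1ℚ - ε) * dnext)) + ((1ℚ + ε) * q - fx))
       + ((1ℚ + ε) - β) * p + ((1ℚ + ε) - β) * ((dstep + dnext) - (p + q)))
  slack-sum = solve 8 (λ β ε dstep dnext p q fv fx →
    β :* ((p :+ q) :- dnext) :+ (ε :+ ε) :* dnext :=
    (β :+ β :- con 1ℚ :- ε) :* dstep :+
      (((((β :* p :+ fx) :- (β :* dstep :+ fv)) :+ (fv :- (con 1ℚ :- ε) :* dnext))
         :+ ((con 1ℚ :+ ε) :* q :- fx))
       :+ ((con 1ℚ :+ ε) :- β) :* p :+ ((con 1ℚ :+ ε) :- β) :* ((dstep :+ dnext) :- (p :+ q))))
    refl β ε dstep dnext p q fv fx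

module _ {n : ℕ} {G : WGraph n} where
  open import Data.List.Membership.DecPropositional (_≟_ {n}) using (_∈?_)

  weaken : ∀ {P Q} → P ⇒ Q → ∀ {u v ℓ} → Walk G P u v ℓ → Walk G Q u v ℓ
  weaken P⇒Q here         = here
  weaken P⇒Q (step e p W) = step e (P⇒Q p) (weaken P⇒Q W)

  _++_ : ∀ {P u v x a b} → Walk G P u v a → Walk G P v x b → Walk G P u x (a + b)
  _++_ {P} {x = x} {b = b} here W′ = subst (Walk G P _ x) (sym (+-identityˡ b)) W′
  _++_ {P} {x = x} {b = b} (step {u} {c = c} {ℓ} e p W) W′ =
    subst (Walk G P u x) (sym (+-assoc c ℓ b)) (step e p (W ++ W′))

  length-nonNeg : ∀ {P u v ℓ} → Walk G P u v ℓ → 0ℚ ≤ ℓ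
  length-nonNeg here = ≤-refl
  length-nonNeg (step {u} {v} {c = c} e _ W) =
    +-mono-≤ (<⇒≤ (w-pos G u v c e)) (length-nonNeg W)

  prefix-isDist : ∀ {P Q u x y p q} → P ⇒ Q → IsDist G Q u y (p + q) →
    Walk G P u x p → Walk G Q x y q → IsDist G P u x p
  prefix-isDist {q = q} P⇒Q (_ , shortest) W₁ W₂ =
    W₁ , λ ℓ W → +-cancelʳ-≤ q (shortest (ℓ + q) (weaken P⇒Q W ++ W₂))

  suffix-isDist : ∀ {P u x y p q} → IsDist G P u y (p + q) →
    Walk G P u x p → Walk G P x y q → IsDist G P x y q
  suffix-isDist {p = p} (_ , shortest) W₁ W₂ =
    W₂ , λ ℓ W → +-cancelˡ-≤ p (shortest (p + ℓ) (W₁ ++ W))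

  record Exit (S : List (Fin n)) (u g : Fin n) (L : ℚ) : Set where
    field
      x        : Fin n
      p q      : ℚ
      inside   : Walk G (Known S) u x p
      outside  : Walk G AllEdges x g q
      length≡  : L ≡ p + q
      x∈∂S     : Boundary G S x

  exit : ∀ S {u g L} → u ∈ S → g ∉ S → Walk G AllEdges u g L → Exit S u g L
  exit S u∈S g∉S here = ⊥-elim (g∉S u∈S)
  exit S {u} u∈S g∉S (step {v = v} {c = c} {ℓ} e _ W) with v ∈? S
  ... | no v∉S = record
    { x = v ; p = c + 0ℚ ; q = ℓ
    ; inside = step e (inj₁ u∈S) here ; outside = W
    ; length≡ = cong (_+ ℓ) (sym (+-identityʳ c))
    ; x∈∂S = v∉S , u , u∈S , c , e }
  ... | yes v∈S = extend (exit S v∈S g∉S W)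
    where
    extend : ∀ {g} → Exit S v g ℓ → Exit S u g (c + ℓ)
    extend E = record
      { x = x ; p = c + p ; q = q
      ; inside = step e (inj₁ u∈S) inside ; outside = outside
      ; length≡ = trans (cong (c +_) length≡) (sym (+-assoc c p q))
      ; x∈∂S = x∈∂S }
      where open Exit E

module _ {n : ℕ} {G : WGraph n} {f : Fin n → ℚ} {β : ℚ} {r g : Fin n} where

  current∈visited : ∀ {u S} → Run G f β r g u S → u ∈ S
  current∈visited start        = here refl
  current∈visited (next _ _ _) = here refl

  goal∉visited : ∀ {u S} → Run G f β r g u S → u ≢ g → g ∉ S
  goal∉visited start         u≢g (here refl) = u≢g refl
  goal∉visited (next _ _ _)  u≢g (here refl) = u≢g refl
  goal∉visited (next R u′≢g _) _ (there g∈S) = goal∉visited R u′≢g g∈S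

lemma8 : ∀ {n : ℕ} (G : WGraph n) (r g : Fin n) (f : Fin n → ℚ) (ε β : ℚ) →
    Connected G →
    0ℚ < ε → ε < 1ℚ → 0ℚ < β →
    (1ℚ + ε) * ½ < β → β < 1ℚ - ε →
    (∀ v δ → IsDist G AllEdges v g δ →
       ((1ℚ - ε) * δ ≤ f v) × (f v ≤ (1ℚ + ε) * δ)) →
    ∀ (u v : Fin n) (S : List (Fin n)) →
    Run G f β r g u S → u ≢ g → Chosen G f β S u v →
    ∀ (dstep dprev dnext : ℚ) →
    IsDist G (Known S) u v dstep →
    IsDist G AllEdges u g dprev →
    IsDist G AllEdges v g dnext →
    (β + β - 1ℚ - ε) * dstep ≤ β * (dprev - dnext) + (ε + ε) * dnext
lemma8 G r g f ε β _ 0<ε _ _ _ β<1-ε prediction u v S run u≢g (_ , greedy)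
       dstep dprev dnext dist-step dist-prev dist-next
  = greedy-step-bound β ε dstep dprev dnext p q (f v) (f x) length≡
    (greedy x p dstep x∈∂S dist-inside dist-step)
    (proj₁ (prediction v dnext dist-next))
    (proj₂ (prediction x q dist-outside))
    (length-nonNeg inside)
    (proj₂ dist-prev (dstep + dnext) (weaken _ (proj₁ dist-step) ++ proj₁ dist-next))
    (<⇒≤ (<-≤-trans β<1-ε (0≤p⇒1-p≤1+p (<⇒≤ 0<ε))))
  where
  open Exit (exit {G = G} S (current∈visited run) (goal∉visited run u≢g) (proj₁ dist-prev))
  dist-prev′ : IsDist G AllEdges u g (p + q)
  dist-prev′ = subst (IsDist G AllEdges u g) length≡ dist-prev
  dist-inside : IsDist G (Known S) u x p
  dist-inside = prefix-isDist _ dist-prev′ inside outside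
  dist-outside : IsDist G AllEdges x g q
  dist-outside = suffix-isDist dist-prev′ (weaken _ inside) outside
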